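{- Let $\Gamma=\mathrm{Cay}(G,S)$ be a connected Cayley graph on the generalized dihedral group $G$, where $S=\{s_1,s_2,t,ts_0\}$ with $s_0,s_1,s_2\in A$, $|S|=4$ and $S\subseteq G\setminus\{e\}$ inverse-closed. If $s_1$ and $s_2$ are involutions, then $\Gamma$ does not admit a perfect code.
   Context: $A$ is a finite abelian group and $G$ is a finite group containing $A$ as a subgroup of index $2$, together with an involution $t\in G\setminus A$ such that $tat=a^{ -1}$ for all $a\in A$. $\mathrm{Cay}(G,S)$ has vertex set $G$, with $x,y$ adjacent iff $yx^{ -1}\in S$. A set $D$ of vertices is a perfect code if every vertex $x$ has exactly one element of $D$ in $\{x\}\cup N(x)$, where $N(x)$ is the neighbourhood of $x$. -}

module Defs where

open import Level using (0ℓ)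
open import Data.Bool using (Bool; true; false; _xor_)
open import Data.Nat using (ℕ)
open import Data.Fin using (Fin)
open import Data.Product using (Σ; ∃!; _×_; _,_)
open import Data.Sum using (_⊎_)
open import Function.Bundles using (_↔_)
open import Relation.Binary.PropositionalEquality using (_≡_)
open import Algebra.Structures using (IsAbelianGroup)

record FinAbGroup : Set₁ where
  field
    Carrier        : Set
    _∙_            : Carrier → Carrier → Carrier
    ε              : Carrier
    _⁻¹            : Carrier → Carrier
    isAbelianGroup : IsAbelianGroup _≡_ _∙_ ε _⁻¹
    finite         : Σ ℕ (λ n → Carrier ↔ Fin n)

module Cayley {X : Set} (_·_ : X → X → X) (inv : X → X) (S : X → Set) where

  Adj : X → X → Set
  Adj x y = S (y · inv x)

  data Walk : X → X → Set where
    here  : ∀ {x} → Walk x x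
    there : ∀ {x y z} → Adj x y → Walk y z → Walk x z

  Connected : Set
  Connected = ∀ x y → Walk x y

  IsPerfectCode : (X → Set) → Set
  IsPerfectCode D = ∀ x → ∃! _≡_ (λ d → D d × (d ≡ x ⊎ Adj x d))

-- The generalized dihedral group Dih(A) = A ⋊ ⟨t⟩ where t a t = a⁻¹.
-- The element (a , b) represents a · t^b (b = true meaning t^1).
module Dih (A : FinAbGroup) where
  open FinAbGroup A

  G : Set
  G = Carrier × Bool

  conj : Bool → Carrier → Carrier
  conj false c = c
  conj true  c = c ⁻¹

  -- (a t^b)(c t^d) = a (t^b c t^{-b}) t^{b xor d}
  _·_ : G → G → G
  (a , b) · (c , d) = (a ∙ conj b c , b xor d)

  e : G
  e = (ε , false)

  inv : G → G
  inv (a , false) = (a ⁻¹ , false)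
  inv (a , true)  = (a , true)

  ι : Carrier → G
  ι a = (a , false)

  t : G
  t = (ε , true)

  Sset : Carrier → Carrier → Carrier → G → Set
  Sset s₀ s₁ s₂ x = x ≡ ι s₁ ⊎ x ≡ ι s₂ ⊎ x ≡ t ⊎ x ≡ t · ι s₀

{-# OPTIONS --safe #-}
-- Call x ↦ s₁x, s₂x shifts (they stay in the coset A or At of x) and x ↦ tx, ts₀x flips (they swap
-- the two cosets), so that N[x] = {x, s₁x, s₂x, tx, ts₀x}; let K = {ε, s₁, s₂, s₁s₂}.
-- First, every coset Kx contains a codeword: otherwise x, s₁x and s₂x are all covered by flips of
-- codewords, two of them by the same flip r, and as r commutes with the involutions s₁, s₂ these two
-- codewords both lie in N[rx].
-- Next, if y is a codeword and r a flip, the codeword of K(ry) must be s₁s₂ry: any other element of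
-- K(ry) lies in N[ry] together with y, but in the other coset of A.
-- Applying this with r = t and then r = ts₀ to a codeword d yields the codeword ts₀·td, which lies
-- in N[td] together with d = t·td; hence ts₀ = t, contradicting |S| = 4.
module Submission where

open import Level using (0ℓ)
open import Defs
open import Algebra.Bundles using (AbelianGroup; Group)
open import Algebra.Structures using (IsGroup)
import Algebra.Properties.AbelianGroup as AbelianGroupProperties
import Algebra.Properties.CommutativeSemigroup as CommutativeSemigroupProperties
import Algebra.Properties.Group as GroupProperties
open import Data.Bool using (true; false; _xor_)
open import Data.Bool.Properties using (xor-assoc; xor-identityʳ; not-¬)
open import Data.Empty using (⊥; ⊥-elim)
open import Data.Product using (Σ; ∃; _×_; _,_; proj₁; proj₂)
open import Data.Sum using (_⊎_; inj₁; inj₂)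
open import Relation.Nullary using (¬_)
open import Relation.Binary.PropositionalEquality
  using (_≡_; _≢_; refl; sym; trans; cong; cong₂; subst; isEquivalence; module ≡-Reasoning)

module GeneralisedDihedral (A : FinAbGroup) where
  open FinAbGroup A
  open Dih A
  open ≡-Reasoning

  abelianGroup : AbelianGroup 0ℓ 0ℓ
  abelianGroup = record { isAbelianGroup = isAbelianGroup }

  open AbelianGroup abelianGroup using (assoc; comm; identityˡ; identityʳ; inverseˡ; inverseʳ)
  open AbelianGroupProperties abelianGroup using (⁻¹-∙-comm; ⁻¹-involutive; ε⁻¹≈ε)

  conj-∙ : ∀ b x y → conj b (x ∙ y) ≡ conj b x ∙ conj b y
  conj-∙ false x y = refl
  conj-∙ true  x y = sym (⁻¹-∙-comm x y)

  conj-conj : ∀ b d x → conj b (conj d x) ≡ conj (b xor d) x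
  conj-conj false d     x = refl
  conj-conj true  false x = refl
  conj-conj true  true  x = ⁻¹-involutive x

  conj-ε : ∀ b → conj b ε ≡ ε
  conj-ε false = refl
  conj-ε true  = ε⁻¹≈ε

  ·-assoc : ∀ x y z → (x · y) · z ≡ x · (y · z)
  ·-assoc (a , b) (c , d) (f , g) = cong₂ _,_ (begin
    (a ∙ conj b c) ∙ conj (b xor d) f   ≡⟨ assoc a _ _ ⟩
    a ∙ (conj b c ∙ conj (b xor d) f)   ≡⟨ cong (λ z → a ∙ (conj b c ∙ z)) (conj-conj b d f) ⟨
    a ∙ (conj b c ∙ conj b (conj d f))  ≡⟨ cong (a ∙_) (conj-∙ b c _) ⟨
    a ∙ conj b (c ∙ conj d f)           ∎)
    (xor-assoc b d g)

  ·-identityˡ : ∀ x → e · x ≡ x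
  ·-identityˡ (a , b) = cong (_, b) (identityˡ a)

  ·-identityʳ : ∀ x → x · e ≡ x
  ·-identityʳ (a , b) = cong₂ _,_ (trans (cong (a ∙_) (conj-ε b)) (identityʳ a)) (xor-identityʳ b)

  ·-inverseˡ : ∀ x → inv x · x ≡ e
  ·-inverseˡ (a , false) = cong (_, false) (inverseˡ a)
  ·-inverseˡ (a , true)  = cong (_, false) (inverseʳ a)

  ·-inverseʳ : ∀ x → x · inv x ≡ e
  ·-inverseʳ (a , false) = cong (_, false) (inverseʳ a)
  ·-inverseʳ (a , true)  = cong (_, false) (inverseʳ a)

  isGroup : IsGroup _≡_ _·_ e inv
  isGroup = record
    { isMonoid = record
      { isSemigroup = record
        { isMagma = record { isEquivalence = isEquivalence ; ∙-cong = cong₂ _·_ }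
        ; assoc   = ·-assoc
        }
      ; identity = ·-identityˡ , ·-identityʳ
      }
    ; inverse = ·-inverseˡ , ·-inverseʳ
    ; ⁻¹-cong = cong inv
    }

  group : Group 0ℓ 0ℓ
  group = record { isGroup = isGroup }

  open GroupProperties group using (inverseʳ-unique)

  reflection-inverts : ∀ c h → (c , true) · ι h ≡ inv (ι h) · (c , true)
  reflection-inverts c h = cong (_, true) (comm c (h ⁻¹))

  reflection-commutes : ∀ c {h} → ι h · ι h ≡ e → (c , true) · ι h ≡ ι h · (c , true)
  reflection-commutes c {h} hh =
    trans (reflection-inverts c h) (cong (_· (c , true)) (sym (inverseʳ-unique (ι h) (ι h) hh)))

  involution-cancel : ∀ g → g · g ≡ e → ∀ y → g · (g · y) ≡ y
  involution-cancel g gg y = trans (sym (·-assoc g g y)) (trans (cong (_· y) gg) (·-identityˡ y))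

module NoPerfectCode (A : FinAbGroup) (s₀ s₁ s₂ : FinAbGroup.Carrier A) where
  open FinAbGroup A
  open Dih A
  open Cayley _·_ inv (Sset s₀ s₁ s₂)
  open GeneralisedDihedral A
  open AbelianGroup abelianGroup using (comm; identityˡ; identityʳ)
  open CommutativeSemigroupProperties (AbelianGroup.commutativeSemigroup abelianGroup)
    using (interchange)
  open GroupProperties group using (//-rightDividesˡ; //-rightDividesʳ; ∙-cancelʳ)
  open ≡-Reasoning

  data Shift : Carrier → Set where
    stay   : Shift ε
    shift₁ : Shift s₁
    shift₂ : Shift s₂

  data Flip : G → Set where
    flip-t   : Flip t
    flip-ts₀ : Flip (t · ι s₀)

  infix 4 _∈N[_]

  data _∈N[_] : G → G → Set where
    shifted : ∀ {h x} → Shift h → ι h · x ∈N[ x ]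
    flipped : ∀ {r x} → Flip r → r · x ∈N[ x ]

  ∈N⇒closedNbhd : ∀ {x y} → y ∈N[ x ] → y ≡ x ⊎ Adj x y
  ∈N⇒closedNbhd {x} (shifted stay)     = inj₁ (·-identityˡ x)
  ∈N⇒closedNbhd {x} (shifted shift₁)   = inj₂ (inj₁ (//-rightDividesʳ x _))
  ∈N⇒closedNbhd {x} (shifted shift₂)   = inj₂ (inj₂ (inj₁ (//-rightDividesʳ x _)))
  ∈N⇒closedNbhd {x} (flipped flip-t)   = inj₂ (inj₂ (inj₂ (inj₁ (//-rightDividesʳ x _))))
  ∈N⇒closedNbhd {x} (flipped flip-ts₀) = inj₂ (inj₂ (inj₂ (inj₂ (//-rightDividesʳ x _))))

  ∈N-by-quotient : ∀ {x y g} → y · inv x ≡ g → g · x ∈N[ x ] → y ∈N[ x ]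
  ∈N-by-quotient {x} {y} refl = subst (_∈N[ x ]) (//-rightDividesˡ x y)

  closedNbhd⇒∈N : ∀ {x y} → y ≡ x ⊎ Adj x y → y ∈N[ x ]
  closedNbhd⇒∈N {x} (inj₁ refl)               = subst (_∈N[ x ]) (·-identityˡ x) (shifted stay)
  closedNbhd⇒∈N (inj₂ (inj₁ q))               = ∈N-by-quotient q (shifted shift₁)
  closedNbhd⇒∈N (inj₂ (inj₂ (inj₁ q)))        = ∈N-by-quotient q (shifted shift₂)
  closedNbhd⇒∈N (inj₂ (inj₂ (inj₂ (inj₁ q)))) = ∈N-by-quotient q (flipped flip-t)
  closedNbhd⇒∈N (inj₂ (inj₂ (inj₂ (inj₂ q)))) = ∈N-by-quotient q (flipped flip-ts₀)

  shift≢flip : ∀ {h r} x → Flip r → ι h · x ≢ r · x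
  shift≢flip (_ , _) flip-t   eq = not-¬ refl (cong proj₂ eq)
  shift≢flip (_ , _) flip-ts₀ eq = not-¬ refl (cong proj₂ eq)

  flip-cancel : ∀ {r} → Flip r → ∀ y → r · (r · y) ≡ y
  flip-cancel flip-t   = involution-cancel t (·-inverseʳ t)
  flip-cancel flip-ts₀ = involution-cancel (t · ι s₀) (·-inverseʳ (t · ι s₀))

  flip-commutes : ∀ {r h} → Flip r → ι h · ι h ≡ e → ∀ y → r · (ι h · y) ≡ ι h · (r · y)
  flip-commutes {r} {h} fr hh y = begin
    r · (ι h · y)  ≡⟨ ·-assoc r (ι h) y ⟨
    (r · ι h) · y  ≡⟨ cong (_· y) (commutes fr) ⟩
    (ι h · r) · y  ≡⟨ ·-assoc (ι h) r y ⟩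
    ι h · (r · y)  ∎
    where
    commutes : ∀ {r} → Flip r → r · ι h ≡ ι h · r
    commutes flip-t   = reflection-commutes ε hh
    commutes flip-ts₀ = reflection-commutes (ε ∙ (s₀ ⁻¹)) hh

  k : Carrier
  k = s₁ ∙ s₂

  data Klein : Carrier → Set where
    shift : ∀ {h} → Shift h → Klein h
    s₁s₂  : Klein k

  module Involutions (s₁-involutive : ι s₁ · ι s₁ ≡ e) (s₂-involutive : ι s₂ · ι s₂ ≡ e) where

    shift-involutive : ∀ {h} → Shift h → ι h · ι h ≡ e
    shift-involutive stay   = ·-identityˡ e
    shift-involutive shift₁ = s₁-involutive
    shift-involutive shift₂ = s₂-involutive

    k-involutive : ι k · ι k ≡ e
    k-involutive = cong ι (begin
      (s₁ ∙ s₂) ∙ (s₁ ∙ s₂)  ≡⟨ interchange s₁ s₂ s₁ s₂ ⟩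
      (s₁ ∙ s₁) ∙ (s₂ ∙ s₂)  ≡⟨ cong₂ _∙_ (cong proj₁ s₁-involutive) (cong proj₁ s₂-involutive) ⟩
      ε ∙ ε                  ≡⟨ identityˡ ε ⟩
      ε                      ∎)

    shift-product : ∀ {g h} → Shift g → Shift h → ∃ λ f → Klein f × g ∙ h ≡ f
    shift-product stay   sh     = _ , shift sh , identityˡ _
    shift-product sg     stay   = _ , shift sg , identityʳ _
    shift-product shift₁ shift₁ = _ , shift stay , cong proj₁ s₁-involutive
    shift-product shift₁ shift₂ = _ , s₁s₂ , refl
    shift-product shift₂ shift₁ = _ , s₁s₂ , comm s₂ s₁
    shift-product shift₂ shift₂ = _ , shift stay , cong proj₁ s₂-involutive

    module Codewords {D : G → Set} (perfect : IsPerfectCode D) where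

      codeword : ∀ x → ∃ λ y → D y × y ∈N[ x ]
      codeword x with perfect x
      ... | y , (Dy , y∈N) , _ = y , Dy , closedNbhd⇒∈N y∈N

      codeword-unique : ∀ {x y z} → D y → D z → y ∈N[ x ] → z ∈N[ x ] → y ≡ z
      codeword-unique {x} Dy Dz y∈N z∈N with perfect x
      ... | _ , _ , unique =
        trans (sym (unique (Dy , ∈N⇒closedNbhd y∈N))) (unique (Dz , ∈N⇒closedNbhd z∈N))

      flip-codeword-back : ∀ {r y} → Flip r → D y → D (r · (r · y))
      flip-codeword-back {y = y} fr = subst D (sym (flip-cancel fr y))

      flipped-codeword-injective : ∀ {r g h x} → Flip r → Shift g → Shift h →
                                   D (r · (ι g · x)) → D (r · (ι h · x)) → ι g ≡ ι h
      flipped-codeword-injective {r} {g} {h} {x} fr sg sh Dg Dh =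
        ∙-cancelʳ (r · x) (ι g) (ι h)
          (codeword-unique (swap sg Dg) (swap sh Dh) (shifted sg) (shifted sh))
        where
        swap : ∀ {f} → Shift f → D (r · (ι f · x)) → D (ι f · (r · x))
        swap sf = subst D (flip-commutes fr (shift-involutive sf) x)

      shifted-twice : ∀ {g h x} → Shift g → Shift h → D (ι g · (ι h · x)) →
                      ∃ λ f → Klein f × D (ι f · x)
      shifted-twice {g} {h} {x} sg sh Dgh with shift-product sg sh
      ... | f , kf , gh≡f =
        f , kf , subst D (trans (sym (·-assoc (ι g) (ι h) x)) (cong (λ a → ι a · x) gh≡f)) Dgh

      module _ (s₁≢s₂ : ι s₁ ≢ ι s₂) (s₁≢e : ι s₁ ≢ e) (s₂≢e : ι s₂ ≢ e) where

        not-all-flipped : ∀ {r₀ r₁ r₂ x} → Flip r₀ → Flip r₁ → Flip r₂ →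
                          D (r₀ · (ι ε · x)) → D (r₁ · (ι s₁ · x)) → D (r₂ · (ι s₂ · x)) → ⊥
        not-all-flipped flip-t flip-t _ D₀ D₁ _ =
          s₁≢e (flipped-codeword-injective flip-t shift₁ stay D₁ D₀)
        not-all-flipped flip-ts₀ flip-ts₀ _ D₀ D₁ _ =
          s₁≢e (flipped-codeword-injective flip-ts₀ shift₁ stay D₁ D₀)
        not-all-flipped flip-t _ flip-t D₀ _ D₂ =
          s₂≢e (flipped-codeword-injective flip-t shift₂ stay D₂ D₀)
        not-all-flipped flip-ts₀ _ flip-ts₀ D₀ _ D₂ =
          s₂≢e (flipped-codeword-injective flip-ts₀ shift₂ stay D₂ D₀)
        not-all-flipped _ flip-t flip-t _ D₁ D₂ =
          s₁≢s₂ (flipped-codeword-injective flip-t shift₁ shift₂ D₁ D₂)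
        not-all-flipped _ flip-ts₀ flip-ts₀ _ D₁ D₂ =
          s₁≢s₂ (flipped-codeword-injective flip-ts₀ shift₁ shift₂ D₁ D₂)

        klein-codeword : ∀ x → ∃ λ h → Klein h × D (ι h · x)
        klein-codeword x with codeword (ι ε · x) | codeword (ι s₁ · x) | codeword (ι s₂ · x)
        ... | _ , Dy , shifted sg | _ | _ = shifted-twice sg stay Dy
        ... | _ | _ , Dy , shifted sg | _ = shifted-twice sg shift₁ Dy
        ... | _ | _ | _ , Dy , shifted sg = shifted-twice sg shift₂ Dy
        ... | _ , D₀ , flipped f₀ | _ , D₁ , flipped f₁ | _ , D₂ , flipped f₂ =
          ⊥-elim (not-all-flipped f₀ f₁ f₂ D₀ D₁ D₂)

        flip-codeword : ∀ {r y} → Flip r → D y → D (ι k · (r · y))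
        flip-codeword {r} {y} fr Dy with klein-codeword (r · y)
        ... | _ , s₁s₂     , Dk = Dk
        ... | _ , shift sh , Dh = ⊥-elim (shift≢flip (r · y) fr
          (codeword-unique Dh (flip-codeword-back fr Dy) (shifted sh) (flipped fr)))

        t≡ts₀ : t ≡ t · ι s₀
        t≡ts₀ with codeword e
        ... | d , Dd , _ = ∙-cancelʳ (t · d) t (t · ι s₀)
          (codeword-unique (flip-codeword-back flip-t Dd) Dd′ (flipped flip-t) (flipped flip-ts₀))
          where
          Dd′ : D ((t · ι s₀) · (t · d))
          Dd′ = subst D (trans (cong (ι k ·_) (flip-commutes flip-ts₀ k-involutive (t · d)))
                               (involution-cancel (ι k) k-involutive _))
                        (flip-codeword flip-ts₀ (flip-codeword flip-t Dd))

  no-perfect-code : ι s₁ ≢ ι s₂ → t ≢ t · ι s₀ →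
                    ι s₁ ≢ e → ι s₁ · ι s₁ ≡ e → ι s₂ ≢ e → ι s₂ · ι s₂ ≡ e →
                    ¬ Σ (G → Set) IsPerfectCode
  no-perfect-code s₁≢s₂ t≢ts₀ s₁≢e s₁-involutive s₂≢e s₂-involutive (_ , perfect) =
    t≢ts₀ (Involutions.Codewords.t≡ts₀ s₁-involutive s₂-involutive perfect s₁≢s₂ s₁≢e s₂≢e)

lemma2p3 : (A : FinAbGroup) → (s₀ s₁ s₂ : FinAbGroup.Carrier A) →
    let open Dih A
        S = Sset s₀ s₁ s₂
        open Cayley _·_ inv S
    in
    -- |S| = 4 : the four listed elements are pairwise distinct
    ι s₁ ≢ ι s₂ → ι s₁ ≢ t → ι s₁ ≢ t · ι s₀ → ι s₂ ≢ t → ι s₂ ≢ t · ι s₀ → t ≢ t · ι s₀ →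
    -- S ⊆ G ∖ {e}
    (∀ x → S x → x ≢ e) →
    -- S inverse-closed
    (∀ x → S x → S (inv x)) →
    -- Γ = Cay(G,S) connected
    Connected →
    -- s₁ and s₂ are involutions
    ι s₁ ≢ e → ι s₁ · ι s₁ ≡ e → ι s₂ ≢ e → ι s₂ · ι s₂ ≡ e →
    -- conclusion: Γ admits no perfect code
    ¬ Σ (G → Set) IsPerfectCode
lemma2p3 A s₀ s₁ s₂ s₁≢s₂ _ _ _ _ t≢ts₀ _ _ _ s₁≢e s₁-involutive s₂≢e s₂-involutive =
  NoPerfectCode.no-perfect-code A s₀ s₁ s₂ s₁≢s₂ t≢ts₀ s₁≢e s₁-involutive s₂≢e s₂-involutive
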